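{- Let $x,y$ be vertices of a configurable graph $H$, let $C=v_1v_2v_3v_4v_5v_1$ be a cycle of length five, and let $P=u_1\cdots u_p$ and $Q=w_1\cdots w_q$ be paths with $p,q\in\{1,2\}$, where $H,C,P,Q$ are pairwise disjoint. Let $G$ be the graph with $V(G)=V(H)\cup V(C)\cup V(P)\cup V(Q)$ and $E(G)=E(H)\cup E(C)\cup E(P)\cup E(Q)\cup\{xu_1, u_pv_1, yw_1, w_qv_3\}$. Then $G$ is configurable.
   Context: $[5]^2$ is the set of $2$-element subsets of $\{1,2,3,4,5\}$. A configuration on a graph $G$ is a map $f:V(G)\to[5]^2$ with $\bigcup_{u\in N[v]} f(u)=\{1,2,3,4,5\}$ for every vertex $v$, where $N[v]$ is the closed neighborhood; $G$ is configurable if it has a configuration. -}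

module Defs where

open import Data.Nat using (ℕ; zero; suc; _≡ᵇ_; _%_; _∸_)
open import Data.Fin using (Fin; toℕ; _≟_)
open import Data.Fin.Subset using (Subset; _∈_; ∣_∣)
open import Data.Bool using (Bool; true; false; _∨_; _∧_; T)
open import Data.Product using (Σ; ∃; _×_)
open import Data.Sum using (_⊎_)
open import Relation.Binary.PropositionalEquality using (_≡_)
open import Relation.Nullary.Decidable using (⌊_⌋)

record Graph (n : ℕ) : Set where
  field
    adj   : Fin n → Fin n → Bool
    sym   : ∀ a b → adj a b ≡ adj b a
    irrefl : ∀ a → adj a a ≡ false
open Graph public

-- [5]^2 : the 2-element subsets of {1,..,5} (here Fin 5 = {0,..,4}).
Pair : Set
Pair = Σ (Subset 5) (λ s → ∣ s ∣ ≡ 2)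

IsConfiguration : {V : Set} → (V → V → Bool) → (V → Pair) → Set
IsConfiguration {V} adj f =
  ∀ (v : V) (c : Fin 5) →
    ∃ λ (u : V) → (u ≡ v ⊎ T (adj v u)) × c ∈ Σ.proj₁ (f u)

Configurable : {V : Set} → (V → V → Bool) → Set
Configurable {V} adj = Σ (V → Pair) (IsConfiguration adj)

ConfigurableGraph : {n : ℕ} → Graph n → Set
ConfigurableGraph H = Configurable (adj H)

-- Vertices of G = V(H) ⊔ V(C) ⊔ V(P) ⊔ V(Q).
-- hv a : vertex a of H;  cv i : v_{i+1} of C;  uv i : u_{i+1} of P;  wv i : w_{i+1} of Q.
data GV (n p q : ℕ) : Set where
  hv : Fin n → GV n p q
  cv : Fin 5 → GV n p q
  uv : Fin p → GV n p q
  wv : Fin q → GV n p q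

pathAdj : {k : ℕ} → Fin k → Fin k → Bool
pathAdj i j = (toℕ j ≡ᵇ suc (toℕ i)) ∨ (toℕ i ≡ᵇ suc (toℕ j))

cycAdj : Fin 5 → Fin 5 → Bool
cycAdj i j = (toℕ j ≡ᵇ (suc (toℕ i) % 5)) ∨ (toℕ i ≡ᵇ (suc (toℕ j) % 5))

Gadj : {n : ℕ} (p q : ℕ) → Graph n → Fin n → Fin n →
       GV n p q → GV n p q → Bool
Gadj p q H x y (hv a) (hv b) = adj H a b
Gadj p q H x y (cv i) (cv j) = cycAdj i j
Gadj p q H x y (uv i) (uv j) = pathAdj i j
Gadj p q H x y (wv i) (wv j) = pathAdj i j
Gadj p q H x y (hv a) (uv i) = ⌊ a ≟ x ⌋ ∧ (toℕ i ≡ᵇ 0)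
Gadj p q H x y (uv i) (hv a) = ⌊ a ≟ x ⌋ ∧ (toℕ i ≡ᵇ 0)
Gadj p q H x y (uv i) (cv j) = (toℕ i ≡ᵇ (p ∸ 1)) ∧ (toℕ j ≡ᵇ 0)
Gadj p q H x y (cv j) (uv i) = (toℕ i ≡ᵇ (p ∸ 1)) ∧ (toℕ j ≡ᵇ 0)
Gadj p q H x y (hv a) (wv i) = ⌊ a ≟ y ⌋ ∧ (toℕ i ≡ᵇ 0)
Gadj p q H x y (wv i) (hv a) = ⌊ a ≟ y ⌋ ∧ (toℕ i ≡ᵇ 0)
Gadj p q H x y (wv i) (cv j) = (toℕ i ≡ᵇ (q ∸ 1)) ∧ (toℕ j ≡ᵇ 2)
Gadj p q H x y (cv j) (wv i) = (toℕ i ≡ᵇ (q ∸ 1)) ∧ (toℕ j ≡ᵇ 2)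
Gadj p q H x y _ _ = false

-- Keep a configuration f of H and choose a ∈ f(x), b ∈ f(y) with a ≠ b, which is possible
-- because f(y) has two elements. Then x supplies a to u₁ and y supplies b to w₁, so it remains
-- to label C ∪ P ∪ Q such that every vertex there sees all five colours in G, except that u₁
-- may miss a and w₁ may miss b. After a permutation of colours taking 0, 1 to a, b this is a
-- finite problem for each (p, q), solved by an explicit labelling that is checked by evaluation.
-- Vertices of H stay covered because their neighbourhoods only grow.

module Submission where

open import Defs hiding (sym)
open import Data.Nat as ℕ using (ℕ; _≤_; _<_; z≤n; s≤s)
open import Data.Nat.Properties using (≤⇒≯)
open import Data.Fin using (Fin; zero; suc; _≟_; _↑ˡ_; punchOut)
open import Data.Fin.Patterns using (0F; 1F; 2F; 3F; 4F)
open import Data.Fin.Properties using (all?; any?; punchIn-punchOut)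
open import Data.Fin.Subset using (Subset; _∈_; _∉_; _⊆_; ∣_∣; ⁅_⁆; _∪_; ⊥)
open import Data.Fin.Subset.Properties
  using (_∈?_; ∣⁅x⁆∣≡1; x∈⁅x⁆; x∈⁅y⁆⇒x≡y; x∉⁅y⁆⇒x≢y; x∈p∪q⁺; x∈p∪q⁻;
         ∪-identityˡ; ∪-identityʳ; p⊆q⇒∣p∣≤∣q∣)
open import Data.Fin.Permutation using (Permutation′; _⟨$⟩ʳ_; _⟨$⟩ˡ_; inverseʳ; insert; id)
open import Data.Vec using (Vec; []; _∷_; lookup)
open import Data.Bool using (Bool; false; _∧_; T)
open import Data.Product using (Σ; ∃; ∃₂; _×_; _,_; proj₁)
open import Data.Sum using (_⊎_; inj₁; inj₂; [_,_])
import Data.Sum as Sum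
open import Function using (_∘_)
open import Function.Bundles using (Injection)
open import Function.Properties.Inverse using (↔⇒↣)
open import Relation.Binary.PropositionalEquality
  using (_≡_; _≢_; refl; sym; trans; cong; subst; subst₂)
open import Relation.Nullary using (Dec; yes; no; contradiction)
open import Relation.Nullary.Decidable
  using (⌊_⌋; False; toWitnessFalse; from-yes; map′; _×-dec_; _⊎-dec_; ¬?; T?; decidable-stable)

∣⁅i⁆∪⁅j⁆∣≡2 : ∀ {n} {i j : Fin n} → i ≢ j → ∣ ⁅ i ⁆ ∪ ⁅ j ⁆ ∣ ≡ 2
∣⁅i⁆∪⁅j⁆∣≡2 {i = zero}  {zero}  0≢0 = contradiction refl 0≢0
∣⁅i⁆∪⁅j⁆∣≡2 {i = zero}  {suc j} _   = cong ℕ.suc (trans (cong ∣_∣ (∪-identityˡ ⁅ j ⁆)) (∣⁅x⁆∣≡1 j))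
∣⁅i⁆∪⁅j⁆∣≡2 {i = suc i} {zero}  _   = cong ℕ.suc (trans (cong ∣_∣ (∪-identityʳ ⁅ i ⁆)) (∣⁅x⁆∣≡1 i))
∣⁅i⁆∪⁅j⁆∣≡2 {i = suc i} {suc j} i≢j = ∣⁅i⁆∪⁅j⁆∣≡2 (i≢j ∘ cong suc)

∣p∣<∣q∣⇒∃∈q∖p : ∀ {n} {p q : Subset n} → ∣ p ∣ < ∣ q ∣ → ∃ λ x → x ∈ q × x ∉ p
∣p∣<∣q∣⇒∃∈q∖p {p = p} {q} ∣p∣<∣q∣ with any? (λ x → x ∈? q ×-dec ¬? (x ∈? p))
... | yes x∈q∖p = x∈q∖p
... | no  ∄x    = contradiction ∣p∣<∣q∣ (≤⇒≯ (p⊆q⇒∣p∣≤∣q∣ q⊆p))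
  where
  q⊆p : q ⊆ p
  q⊆p {x} x∈q = decidable-stable (x ∈? p) (λ x∉p → ∄x (x , x∈q , x∉p))

distinct-members : (s t : Pair) → ∃₂ λ a b → a ∈ proj₁ s × b ∈ proj₁ t × a ≢ b
distinct-members (s , ∣s∣≡2) (t , ∣t∣≡2) with ∣p∣<∣q∣⇒∃∈q∖p {p = ⊥} (subst (0 <_) (sym ∣s∣≡2) (s≤s z≤n))
... | a , a∈s , _ with ∣p∣<∣q∣⇒∃∈q∖p (subst₂ _<_ (sym (∣⁅x⁆∣≡1 a)) (sym ∣t∣≡2) (s≤s (s≤s z≤n)))
... | b , b∈t , b∉⁅a⁆ = a , b , a∈s , b∈t , x∉⁅y⁆⇒x≢y b∉⁅a⁆ ∘ sym

record ColourPair : Set where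
  constructor colourPair
  field
    fst snd : Fin 5
    fst≢snd : fst ≢ snd

⟨_,_⟩ : (i j : Fin 5) → {False (i ≟ j)} → ColourPair
⟨ i , j ⟩ {i≢j} = colourPair i j (toWitnessFalse i≢j)

⟦_⟧ : ColourPair → Pair
⟦ colourPair i j i≢j ⟧ = ⁅ i ⁆ ∪ ⁅ j ⁆ , ∣⁅i⁆∪⁅j⁆∣≡2 i≢j

_⊙_ : Permutation′ 5 → ColourPair → ColourPair
σ ⊙ colourPair i j i≢j = colourPair (σ ⟨$⟩ʳ i) (σ ⟨$⟩ʳ j) (i≢j ∘ Injection.injective (↔⇒↣ σ))

∈-⊙ : ∀ σ P {k} → k ∈ proj₁ ⟦ P ⟧ → σ ⟨$⟩ʳ k ∈ proj₁ ⟦ σ ⊙ P ⟧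
∈-⊙ σ (colourPair i j _) {k} k∈P = x∈p∪q⁺ (Sum.map (permute i) (permute j) (x∈p∪q⁻ ⁅ i ⁆ ⁅ j ⁆ k∈P))
  where
  permute : ∀ l → k ∈ ⁅ l ⁆ → σ ⟨$⟩ʳ k ∈ ⁅ σ ⟨$⟩ʳ l ⁆
  permute l k∈⁅l⁆ with refl ← x∈⁅y⁆⇒x≡y l k∈⁅l⁆ = x∈⁅x⁆ _

pin₀₁ : ∀ {n} {a b : Fin (ℕ.suc (ℕ.suc n))} → a ≢ b → Permutation′ (ℕ.suc (ℕ.suc n))
pin₀₁ {a = a} a≢b = insert 0F a (insert 0F (punchOut a≢b) id)

pin₀₁-1 : ∀ {n} {a b : Fin (ℕ.suc (ℕ.suc n))} (a≢b : a ≢ b) → pin₀₁ a≢b ⟨$⟩ʳ 1F ≡ b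
pin₀₁-1 a≢b = punchIn-punchOut a≢b

-- IsConfiguration adj f unfolds to ∀ v → Covered adj (proj₁ ∘ f) v.
Covered : {V : Set} → (V → V → Bool) → (V → Subset 5) → V → Set
Covered {V} adj L v = ∀ c → ∃ λ (u : V) → (u ≡ v ⊎ T (adj v u)) × c ∈ L u

Covered-map : ∀ {V W : Set} {adjV : V → V → Bool} {adjW : W → W → Bool}
              {L : V → Subset 5} {M : W → Subset 5} (φ : V → W) (σ : Permutation′ 5) {v : V} →
              (∀ u → T (adjV v u) → T (adjW (φ v) (φ u))) →
              (∀ u {k} → k ∈ L u → σ ⟨$⟩ʳ k ∈ M (φ u)) →
              Covered adjV L v → Covered adjW M (φ v)
Covered-map φ σ hom label cov c with cov (σ ⟨$⟩ˡ c)
... | u , u∈N[v] , σ⁻¹c∈Lu =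
  φ u , [ inj₁ ∘ cong φ , inj₂ ∘ hom u ] u∈N[v] , subst (_∈ _) (inverseʳ σ) (label u σ⁻¹c∈Lu)

-- Decidable without equality on vertices.
Covered′ : {V : Set} → (V → V → Bool) → (V → Subset 5) → V → Set
Covered′ {V} adj L v = ∀ c → c ∈ L v ⊎ ∃ λ (u : V) → T (adj v u) × c ∈ L u

Covered′⇒Covered : ∀ {V : Set} {adj : V → V → Bool} {L : V → Subset 5} {v : V} →
                   Covered′ adj L v → Covered adj L v
Covered′⇒Covered {v = v} cov c with cov c
... | inj₁ c∈Lv             = v , inj₁ refl , c∈Lv
... | inj₂ (u , v~u , c∈Lu) = u , inj₂ v~u , c∈Lu

module _ {n p q : ℕ} where

  ∃-GV? : {P : GV n p q → Set} → (∀ u → Dec (P u)) → Dec (∃ P)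
  ∃-GV? {P} P? = map′ from to (any? (P? ∘ hv) ⊎-dec any? (P? ∘ cv) ⊎-dec any? (P? ∘ uv) ⊎-dec any? (P? ∘ wv))
    where
    from : ∃ (P ∘ hv) ⊎ ∃ (P ∘ cv) ⊎ ∃ (P ∘ uv) ⊎ ∃ (P ∘ wv) → ∃ P
    from (inj₁ (a , Pa))               = hv a , Pa
    from (inj₂ (inj₁ (i , Pi)))        = cv i , Pi
    from (inj₂ (inj₂ (inj₁ (i , Pi)))) = uv i , Pi
    from (inj₂ (inj₂ (inj₂ (i , Pi)))) = wv i , Pi
    to : ∃ P → ∃ (P ∘ hv) ⊎ ∃ (P ∘ cv) ⊎ ∃ (P ∘ uv) ⊎ ∃ (P ∘ wv)
    to (hv a , Pa) = inj₁ (a , Pa)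
    to (cv i , Pi) = inj₂ (inj₁ (i , Pi))
    to (uv i , Pi) = inj₂ (inj₂ (inj₁ (i , Pi)))
    to (wv i , Pi) = inj₂ (inj₂ (inj₂ (i , Pi)))

  Covered′? : (adj : GV n p q → GV n p q → Bool) (L : GV n p q → Subset 5) → ∀ v → Dec (Covered′ adj L v)
  Covered′? adj L v = all? λ c → c ∈? L v ⊎-dec ∃-GV? λ u → T? (adj v u) ×-dec c ∈? L u

  OnGadget : (GV n p q → Set) → Set
  OnGadget P = (∀ i → P (cv i)) × (∀ i → P (uv i)) × (∀ i → P (wv i))

  onGadget? : {P : GV n p q → Set} → (∀ v → Dec (P v)) → Dec (OnGadget P)
  onGadget? P? = all? (P? ∘ cv) ×-dec all? (P? ∘ uv) ×-dec all? (P? ∘ wv)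

record GadgetColouring (p q : ℕ) : Set where
  field
    onC : Vec ColourPair 5
    onP : Vec ColourPair p
    onQ : Vec ColourPair q
open GadgetColouring

extend : ∀ {n p q} {A : Set} → (Fin n → A) → (ColourPair → A) → GadgetColouring p q → GV n p q → A
extend f g γ (hv a) = f a
extend f g γ (cv i) = g (lookup (onC γ) i)
extend f g γ (uv i) = g (lookup (onP γ) i)
extend f g γ (wv i) = g (lookup (onQ γ) i)

edgeless : (n : ℕ) → Graph n
edgeless n = record { adj = λ _ _ → false ; sym = λ _ _ → refl ; irrefl = λ _ → refl }

-- The gadget with x and y replaced by two fresh vertices that supply only the colours 0 and 1.
standInAdj : (p q : ℕ) → GV 2 p q → GV 2 p q → Bool
standInAdj p q = Gadj p q (edgeless 2) 0F 1F

standIn : ∀ {p q} → GadgetColouring p q → GV 2 p q → Subset 5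
standIn = extend (λ i → ⁅ i ↑ˡ 3 ⁆) (proj₁ ∘ ⟦_⟧)

Valid : ∀ {p q} → GadgetColouring p q → Set
Valid {p} {q} γ = OnGadget (Covered′ (standInAdj p q) (standIn γ))

valid? : ∀ {p q} (γ : GadgetColouring p q) → Dec (Valid γ)
valid? {p} {q} γ = onGadget? (Covered′? (standInAdj p q) (standIn γ))

validColouring : ∀ {p q} → 1 ≤ p → p ≤ 2 → 1 ≤ q → q ≤ 2 → Σ (GadgetColouring p q) Valid
validColouring {1} {1} _ _ _ _ = γ , from-yes (valid? γ)
  where
  γ : GadgetColouring 1 1
  γ = record { onC = ⟨ 1F , 2F ⟩ ∷ ⟨ 0F , 3F ⟩ ∷ ⟨ 2F , 4F ⟩ ∷ ⟨ 0F , 1F ⟩ ∷ ⟨ 3F , 4F ⟩ ∷ []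
             ; onP = ⟨ 3F , 4F ⟩ ∷ []
             ; onQ = ⟨ 0F , 3F ⟩ ∷ [] }
validColouring {1} {2} _ _ _ _ = γ , from-yes (valid? γ)
  where
  γ : GadgetColouring 1 2
  γ = record { onC = ⟨ 1F , 2F ⟩ ∷ ⟨ 0F , 3F ⟩ ∷ ⟨ 1F , 4F ⟩ ∷ ⟨ 0F , 2F ⟩ ∷ ⟨ 3F , 4F ⟩ ∷ []
             ; onP = ⟨ 3F , 4F ⟩ ∷ []
             ; onQ = ⟨ 0F , 2F ⟩ ∷ ⟨ 3F , 4F ⟩ ∷ [] }
validColouring {2} {1} _ _ _ _ = γ , from-yes (valid? γ)
  where
  γ : GadgetColouring 2 1
  γ = record { onC = ⟨ 0F , 1F ⟩ ∷ ⟨ 2F , 3F ⟩ ∷ ⟨ 0F , 4F ⟩ ∷ ⟨ 1F , 2F ⟩ ∷ ⟨ 3F , 4F ⟩ ∷ []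
             ; onP = ⟨ 1F , 2F ⟩ ∷ ⟨ 3F , 4F ⟩ ∷ []
             ; onQ = ⟨ 2F , 3F ⟩ ∷ [] }
validColouring {2} {2} _ _ _ _ = γ , from-yes (valid? γ)
  where
  γ : GadgetColouring 2 2
  γ = record { onC = ⟨ 0F , 1F ⟩ ∷ ⟨ 2F , 3F ⟩ ∷ ⟨ 1F , 4F ⟩ ∷ ⟨ 0F , 2F ⟩ ∷ ⟨ 3F , 4F ⟩ ∷ []
             ; onP = ⟨ 1F , 2F ⟩ ∷ ⟨ 3F , 4F ⟩ ∷ []
             ; onQ = ⟨ 0F , 2F ⟩ ∷ ⟨ 3F , 4F ⟩ ∷ [] }
validColouring {0} () _ _ _
validColouring {ℕ.suc (ℕ.suc (ℕ.suc _))} _ (s≤s (s≤s ())) _ _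
validColouring {_} {0} _ _ () _
validColouring {_} {ℕ.suc (ℕ.suc (ℕ.suc _))} _ _ _ (s≤s (s≤s ()))

module _ {n p q : ℕ} (H : Graph n) (x y : Fin n) where

  fillIn : GV 2 p q → GV n p q
  fillIn (hv 0F) = hv x
  fillIn (hv 1F) = hv y
  fillIn (cv i)  = cv i
  fillIn (uv i)  = uv i
  fillIn (wv i)  = wv i

  private
    ≟-refl-∧ : (z : Fin n) {b : Bool} → T b → T (⌊ z ≟ z ⌋ ∧ b)
    ≟-refl-∧ z t with z ≟ z
    ... | yes _   = t
    ... | no  z≢z = contradiction refl z≢z

  fillIn-hom : ∀ v u → T (standInAdj p q v u) → T (Gadj p q H x y (fillIn v) (fillIn u))
  fillIn-hom (hv _)  (hv _)  ()
  fillIn-hom (hv _)  (cv _)  ()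
  fillIn-hom (hv 0F) (uv _)  t = ≟-refl-∧ x t
  fillIn-hom (hv 1F) (uv _)  ()
  fillIn-hom (hv 0F) (wv _)  ()
  fillIn-hom (hv 1F) (wv _)  t = ≟-refl-∧ y t
  fillIn-hom (cv _)  (hv _)  ()
  fillIn-hom (cv _)  (cv _)  t = t
  fillIn-hom (cv _)  (uv _)  t = t
  fillIn-hom (cv _)  (wv _)  t = t
  fillIn-hom (uv _)  (hv 0F) t = ≟-refl-∧ x t
  fillIn-hom (uv _)  (hv 1F) ()
  fillIn-hom (uv _)  (cv _)  t = t
  fillIn-hom (uv _)  (uv _)  t = t
  fillIn-hom (uv _)  (wv _)  t = t
  fillIn-hom (wv _)  (hv 0F) ()
  fillIn-hom (wv _)  (hv 1F) t = ≟-refl-∧ y t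
  fillIn-hom (wv _)  (cv _)  t = t
  fillIn-hom (wv _)  (uv _)  t = t
  fillIn-hom (wv _)  (wv _)  t = t

  attach : (f : Fin n → Pair) → IsConfiguration (adj H) f →
           (γ : GadgetColouring p q) → Valid γ →
           ∀ {a b} → a ∈ proj₁ (f x) → b ∈ proj₁ (f y) → a ≢ b →
           Configurable (Gadj p q H x y)
  attach f f-conf γ (onC-covered , onP-covered , onQ-covered) a∈fx b∈fy a≢b = g , g-conf
    where
    σ : Permutation′ 5
    σ = pin₀₁ a≢b

    g : GV n p q → Pair
    g = extend f (⟦_⟧ ∘ (σ ⊙_)) γ

    relabel : ∀ u {k} → k ∈ standIn γ u → σ ⟨$⟩ʳ k ∈ proj₁ (g (fillIn u))
    relabel (hv 0F) k∈⁅0⁆ with refl ← x∈⁅y⁆⇒x≡y 0F k∈⁅0⁆ = a∈fx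
    relabel (hv 1F) k∈⁅1⁆ with refl ← x∈⁅y⁆⇒x≡y 1F k∈⁅1⁆ = subst (_∈ proj₁ (f y)) (sym (pin₀₁-1 a≢b)) b∈fy
    relabel (cv i) = ∈-⊙ σ (lookup (onC γ) i)
    relabel (uv i) = ∈-⊙ σ (lookup (onP γ) i)
    relabel (wv i) = ∈-⊙ σ (lookup (onQ γ) i)

    gadget-covered : ∀ {v} → Covered′ (standInAdj p q) (standIn γ) v →
                     Covered (Gadj p q H x y) (proj₁ ∘ g) (fillIn v)
    gadget-covered {v} covered =
      Covered-map {adjV = standInAdj p q} {adjW = Gadj p q H x y} fillIn σ (fillIn-hom v) relabel
                  (Covered′⇒Covered {adj = standInAdj p q} covered)

    g-conf : IsConfiguration (Gadj p q H x y) g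
    g-conf (hv v) = Covered-map {adjV = adj H} {adjW = Gadj p q H x y} hv id
                                (λ _ v~u → v~u) (λ _ k∈fu → k∈fu) (f-conf v)
    g-conf (cv i) = gadget-covered (onC-covered i)
    g-conf (uv i) = gadget-covered (onP-covered i)
    g-conf (wv i) = gadget-covered (onQ-covered i)

lemma2p7 : {n : ℕ} (H : Graph n) (x y : Fin n) (p q : ℕ) →
           1 ≤ p → p ≤ 2 → 1 ≤ q → q ≤ 2 →
           ConfigurableGraph H →
           Configurable (Gadj p q H x y)
lemma2p7 H x y p q 1≤p p≤2 1≤q q≤2 (f , f-conf) =
  let γ , γ-valid = validColouring 1≤p p≤2 1≤q q≤2
      a , b , a∈fx , b∈fy , a≢b = distinct-members (f x) (f y)
  in  attach H x y f f-conf γ γ-valid a∈fx b∈fy a≢b
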